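{- Let $n\ge1$. Let $A_n(t)=\sum_{\pi\in\mathfrak{S}_n}t^{\mathrm{des}(\pi)}$ be the Eulerian polynomial, where $\mathfrak{S}_n$ is the set of permutations of $[n]$ and $\mathrm{des}(\pi)=|\{i\in[n-1]:\pi_i>\pi_{i+1}\}|$. A segmented permutation of $[n]$ is a permutation $\sigma=\sigma_1\cdots\sigma_n$ of $[n]$ together with a choice, for each slot between consecutive letters $\sigma_i,\sigma_{i+1}$ ($1\le i\le n-1$), of whether a bar is placed there; let $\mathcal{SP}_n$ be the set of these. For $\sigma\in\mathcal{SP}_n$ let $\mathrm{des}(\sigma)$ be the number of $i\in[n-1]$ with $\sigma_i>\sigma_{i+1}$ and no bar between $\sigma_i$ and $\sigma_{i+1}$, and $\mathrm{seg}(\sigma)$ the number of bars. Let $\alpha_n(t,q)=\sum_{\sigma\in\mathcal{SP}_n}t^{\mathrm{des}(\sigma)}q^{\mathrm{seg}(\sigma)}$ and $P_n(t)=\sum_{\sigma\in\mathcal{SP}_n}t^{\mathrm{des}(\sigma)}$. Then $$\alpha_n(t,q)=(1+q)^{n-1}A_n\!\left(\frac{t+q}{1+q}\right)\quad\text{and}\quad P_n(t)=2^{n-1}A_n\!\left(\frac{t+1}{2}\right).$$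
   Context: The first identity is an identity of polynomials: writing $A_n(t)=\sum_{k=0}^{n-1}A(n,k)t^k$, its right-hand side means $\sum_{k=0}^{n-1}A(n,k)(t+q)^k(1+q)^{n-1-k}$. -}

module Defs where

open import Level using (Level)
open import Data.Nat using (ℕ; zero; suc; _∸_; _<ᵇ_)
import Data.Nat as N
open import Data.Bool using (Bool; true; false; if_then_else_; not; _∧_)
open import Data.Fin using (Fin; toℕ)
open import Data.Fin.Properties using (_≟_)
open import Data.List using (List; []; _∷_; map; concatMap; filter; allFin; upTo; length)
open import Data.Vec using (Vec; []; _∷_; toList)
open import Data.Product using (_×_; _,_)
open import Algebra.Bundles using (CommutativeSemiring)
import Data.List.Relation.Unary.Unique.DecPropositional as UD
import Algebra.Definitions.RawSemiring as RS

words : (k m : ℕ) → List (Vec (Fin k) m)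
words k zero    = [] ∷ []
words k (suc m) = concatMap (λ x → map (x ∷_) (words k m)) (allFin k)

-- The symmetric group S_n, as the list of all permutations of [n]
-- in one-line notation π₁⋯πₙ (letters are Fin n, i.e. [n] shifted to 0..n-1,
-- which preserves the order): exactly the words of length n with distinct letters.
perms : (n : ℕ) → List (Vec (Fin n) n)
perms n = filter (λ w → UD.unique? (_≟_ {n}) (toList w)) (words n n)

-- All bar choices: one Bool for each of the n-1 slots between consecutive letters
-- (true = a bar is placed in that slot).
barChoices : (m : ℕ) → List (Vec Bool m)
barChoices zero    = [] ∷ []
barChoices (suc m) = concatMap (λ b → map (b ∷_) (barChoices m)) (true ∷ false ∷ [])

SP : (n : ℕ) → List (Vec (Fin n) n × Vec Bool (n ∸ 1))
SP n = concatMap (λ π → map (π ,_) (barChoices (n ∸ 1))) (perms n)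

desL : ∀ {k} → List (Fin k) → ℕ
desL []           = 0
desL (x ∷ [])     = 0
desL (x ∷ y ∷ xs) = (if toℕ y <ᵇ toℕ x then 1 else 0) N.+ desL (y ∷ xs)

des : ∀ {n} → Vec (Fin n) n → ℕ
des π = desL (toList π)

desSegL : ∀ {k} → List (Fin k) → List Bool → ℕ
desSegL (x ∷ y ∷ xs) (b ∷ bs) =
  (if not b ∧ (toℕ y <ᵇ toℕ x) then 1 else 0) N.+ desSegL (y ∷ xs) bs
desSegL _ _ = 0

desSP : ∀ {n} → Vec (Fin n) n × Vec Bool (n ∸ 1) → ℕ
desSP (π , bars) = desSegL (toList π) (toList bars)

countTrue : ∀ {m} → Vec Bool m → ℕ
countTrue []          = 0
countTrue (true ∷ bs) = suc (countTrue bs)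
countTrue (false ∷ bs) = countTrue bs

seg : ∀ {n} → Vec (Fin n) n × Vec Bool (n ∸ 1) → ℕ
seg (π , bars) = countTrue bars

eulerian : ℕ → ℕ → ℕ
eulerian n k = length (filter (λ π → des π N.≟ k) (perms n))

module _ {c ℓ : Level} (R : CommutativeSemiring c ℓ) where
  open CommutativeSemiring R
  open RS rawSemiring using (_^_) renaming (_×_ to _·_)

  Σ : ∀ {a} {X : Set a} → List X → (X → Carrier) → Carrier
  Σ []       f = 0#
  Σ (x ∷ xs) f = f x + Σ xs f

  α : ℕ → Carrier → Carrier → Carrier
  α n t q = Σ (SP n) (λ σ → (t ^ desSP σ) * (q ^ seg σ))

  P : ℕ → Carrier → Carrier
  P n t = Σ (SP n) (λ σ → t ^ desSP σ)

  -- (1+q)^{n-1} A_n((t+q)/(1+q)) := Σ_{k=0}^{n-1} A(n,k) (t+q)^k (1+q)^{n-1-k}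
  rhsα : ℕ → Carrier → Carrier → Carrier
  rhsα n t q = Σ (upTo n) (λ k →
    eulerian n k · (((t + q) ^ k) * ((1# + q) ^ (n ∸ 1 ∸ k))))

  -- 2^{n-1} A_n((t+1)/2) := Σ_{k=0}^{n-1} A(n,k) (t+1)^k 2^{n-1-k}
  rhsP : ℕ → Carrier → Carrier
  rhsP n t = Σ (upTo n) (λ k →
    eulerian n k · (((t + 1#) ^ k) * ((1# + 1#) ^ (n ∸ 1 ∸ k))))

-- Fix a permutation π with k descents and sum over its bar placements. The slots are
-- independent: a descent slot contributes t without a bar and q with one, an ascent slot
-- 1 and q, so π contributes (t + q)^k (1 + q)^(n-1-k). Grouping the permutations by their
-- number of descents turns the sum into Σ_k A(n,k) (t + q)^k (1 + q)^(n-1-k); P_n is q = 1.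
module Submission where

open import Defs
open import Level using (Level)
open import Data.Nat using (ℕ; _≤_)
open import Data.Product using (_×_)
open import Algebra.Bundles using (CommutativeSemiring)

open import Data.Nat using (zero; suc; _<_; _∸_; _<ᵇ_; _≟_; z≤n; s≤s)
open import Data.Nat.Properties using (+-∸-assoc; m≤n⇒m≤1+n; ≤-pred; ≤∧≢⇒<; <⇒≢)
open import Data.Bool using (Bool; true; false; if_then_else_)
open import Data.Fin using (Fin; toℕ)
open import Data.Vec using (Vec; []; _∷_; toList)
open import Data.List using (List; []; _∷_; _++_; [_]; map; concatMap; filter; upTo; length)
open import Data.List.Properties using (upTo-∷ʳ)
open import Data.List.Relation.Unary.All using (All; []; _∷_)
open import Data.List.Relation.Unary.All.Properties using (applyUpTo⁺₁; applyUpTo⁺₂)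
open import Data.Product using (_,_)
open import Function using (id; _∘_)
open import Relation.Nullary using (¬_; does; yes; no)
open import Relation.Nullary.Decidable using (dec-true; dec-false)
open import Relation.Binary.PropositionalEquality as ≡ using (_≡_)
import Algebra.Definitions.RawSemiring as RawSemiring
import Algebra.Properties.Semiring.Exp as Exp
import Algebra.Properties.CommutativeSemigroup as CommutativeSemigroupProperties

desL-≤ : ∀ {k} m (v : Vec (Fin k) (suc m)) → desL (toList v) ≤ m
desL-≤ zero    (x ∷ [])    = z≤n
desL-≤ (suc m) (x ∷ y ∷ w) with toℕ y <ᵇ toℕ x
... | true  = s≤s (desL-≤ m (y ∷ w))
... | false = m≤n⇒m≤1+n (desL-≤ m (y ∷ w))

module _ {c ℓ : Level} (R : CommutativeSemiring c ℓ) where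
  open CommutativeSemiring R
  open RawSemiring rawSemiring using (_^_) renaming (_×_ to _·_)
  open Exp semiring using (^-homo-*)
  open CommutativeSemigroupProperties +-commutativeSemigroup using (interchange)
  open import Relation.Binary.Reasoning.Setoid setoid

  Σ-cong : ∀ {a} {X : Set a} (xs : List X) {f g : X → Carrier} →
           (∀ x → f x ≈ g x) → Σ R xs f ≈ Σ R xs g
  Σ-cong []       f≈g = refl
  Σ-cong (x ∷ xs) f≈g = +-cong (f≈g x) (Σ-cong xs f≈g)

  Σ-≈0 : ∀ {a} {X : Set a} {xs : List X} (f : X → Carrier) →
         All (λ x → f x ≈ 0#) xs → Σ R xs f ≈ 0#
  Σ-≈0 f []           = refl
  Σ-≈0 f (fx≈0 ∷ all) = trans (+-cong fx≈0 (Σ-≈0 f all)) (+-identityˡ 0#)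

  Σ-++ : ∀ {a} {X : Set a} (xs ys : List X) (f : X → Carrier) →
         Σ R (xs ++ ys) f ≈ Σ R xs f + Σ R ys f
  Σ-++ []       ys f = sym (+-identityˡ _)
  Σ-++ (x ∷ xs) ys f = trans (+-congˡ (Σ-++ xs ys f)) (sym (+-assoc _ _ _))

  Σ-map : ∀ {a b} {X : Set a} {Y : Set b} (h : X → Y) (xs : List X) (f : Y → Carrier) →
          Σ R (map h xs) f ≈ Σ R xs (f ∘ h)
  Σ-map h []       f = refl
  Σ-map h (x ∷ xs) f = +-congˡ (Σ-map h xs f)

  Σ-concatMap : ∀ {a b} {X : Set a} {Y : Set b} (g : X → List Y) (xs : List X) (f : Y → Carrier) →
                Σ R (concatMap g xs) f ≈ Σ R xs (λ x → Σ R (g x) f)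
  Σ-concatMap g []       f = refl
  Σ-concatMap g (x ∷ xs) f = trans (Σ-++ (g x) (concatMap g xs) f) (+-congˡ (Σ-concatMap g xs f))

  Σ-distrib-+ : ∀ {a} {X : Set a} (xs : List X) (f g : X → Carrier) →
                Σ R xs (λ x → f x + g x) ≈ Σ R xs f + Σ R xs g
  Σ-distrib-+ []       f g = sym (+-identityˡ 0#)
  Σ-distrib-+ (x ∷ xs) f g = trans (+-congˡ (Σ-distrib-+ xs f g)) (interchange _ _ _ _)

  *-distribˡ-Σ : ∀ {a} {X : Set a} (r : Carrier) (xs : List X) (f : X → Carrier) →
                 r * Σ R xs f ≈ Σ R xs (λ x → r * f x)
  *-distribˡ-Σ r []       f = zeroʳ r
  *-distribˡ-Σ r (x ∷ xs) f = trans (distribˡ r _ _) (+-congˡ (*-distribˡ-Σ r xs f))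

  Σ-upTo-suc : ∀ N (g : ℕ → Carrier) → Σ R (upTo (suc N)) g ≈ Σ R (upTo N) g + g N
  Σ-upTo-suc N g = begin
    Σ R (upTo (suc N)) g         ≡⟨ ≡.cong (λ l → Σ R l g) (upTo-∷ʳ N) ⟨
    Σ R (upTo N ++ [ N ]) g      ≈⟨ Σ-++ (upTo N) [ N ] g ⟩
    Σ R (upTo N) g + (g N + 0#)  ≈⟨ +-congˡ (+-identityʳ _) ⟩
    Σ R (upTo N) g + g N         ∎

  δ : ℕ → ℕ → Carrier → Carrier
  δ j k x = if does (j ≟ k) then x else 0#

  δ-≢ : ∀ {j k} x → ¬ j ≡ k → δ j k x ≈ 0#
  δ-≢ {j} {k} x j≢k rewrite dec-false (j ≟ k) j≢k = refl

  δ-diag : ∀ j x → δ j j x ≈ x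
  δ-diag j x rewrite dec-true (j ≟ j) ≡.refl = refl

  Σ-upTo-δ : ∀ N {j} (F : ℕ → Carrier) → j < N → Σ R (upTo N) (λ k → δ j k (F k)) ≈ F j
  Σ-upTo-δ (suc N) {j} F j<1+N with j ≟ N
  ... | yes ≡.refl = begin
    Σ R (upTo (suc j)) (λ k → δ j k (F k))      ≈⟨ Σ-upTo-suc j _ ⟩
    Σ R (upTo j) (λ k → δ j k (F k)) + δ j j (F j)
      ≈⟨ +-cong (Σ-≈0 _ (applyUpTo⁺₁ id j (λ k<j → δ-≢ _ (<⇒≢ k<j ∘ ≡.sym)))) (δ-diag j (F j)) ⟩
    0# + F j                                    ≈⟨ +-identityˡ _ ⟩
    F j                                         ∎
  ... | no j≢N = begin
    Σ R (upTo (suc N)) (λ k → δ j k (F k))      ≈⟨ Σ-upTo-suc N _ ⟩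
    Σ R (upTo N) (λ k → δ j k (F k)) + δ j N (F N)
      ≈⟨ +-cong (Σ-upTo-δ N F (≤∧≢⇒< (≤-pred j<1+N) j≢N)) (δ-≢ (F N) j≢N) ⟩
    F j + 0#                                    ≈⟨ +-identityʳ _ ⟩
    F j                                         ∎

  Σ-groupBy : ∀ {a} {X : Set a} (d : X → ℕ) (F : ℕ → Carrier) N → (∀ x → d x < N) →
              ∀ xs → Σ R xs (F ∘ d) ≈ Σ R (upTo N) (λ k → length (filter (λ x → d x ≟ k) xs) · F k)
  Σ-groupBy d F N d<N []       = sym (Σ-≈0 _ (applyUpTo⁺₂ id N (λ _ → refl)))
  Σ-groupBy {X = X} d F N d<N (x ∷ xs) = begin
    F (d x) + Σ R xs (F ∘ d)
      ≈⟨ +-cong (sym (Σ-upTo-δ N F (d<N x))) (Σ-groupBy d F N d<N xs) ⟩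
    Σ R (upTo N) (λ k → δ (d x) k (F k)) + Σ R (upTo N) (λ k → count xs k · F k)
      ≈⟨ Σ-distrib-+ (upTo N) _ _ ⟨
    Σ R (upTo N) (λ k → δ (d x) k (F k) + count xs k · F k)
      ≈⟨ Σ-cong (upTo N) count-∷ ⟩
    Σ R (upTo N) (λ k → count (x ∷ xs) k · F k) ∎
    where
    count : List X → ℕ → ℕ
    count ys k = length (filter (λ y → d y ≟ k) ys)
    count-∷ : ∀ k → δ (d x) k (F k) + count xs k · F k ≈ count (x ∷ xs) k · F k
    count-∷ k with does (d x ≟ k)
    ... | true  = refl
    ... | false = +-identityˡ _

  Σ-barChoices-suc : ∀ m (h : Vec Bool (suc m) → Carrier) →
    Σ R (barChoices (suc m)) h ≈ Σ R (barChoices m) (h ∘ (true ∷_)) + Σ R (barChoices m) (h ∘ (false ∷_))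
  Σ-barChoices-suc m h = begin
    Σ R (barChoices (suc m)) h
      ≈⟨ Σ-concatMap (λ b → map (b ∷_) (barChoices m)) (true ∷ false ∷ []) h ⟩
    Σ R (map (true ∷_) (barChoices m)) h + (Σ R (map (false ∷_) (barChoices m)) h + 0#)
      ≈⟨ +-cong (Σ-map (true ∷_) (barChoices m) h)
                (trans (+-identityʳ _) (Σ-map (false ∷_) (barChoices m) h)) ⟩
    Σ R (barChoices m) (h ∘ (true ∷_)) + Σ R (barChoices m) (h ∘ (false ∷_)) ∎

  slotProduct : ∀ {k} → Carrier → Carrier → List (Fin k) → Carrier
  slotProduct a b (x ∷ y ∷ xs) = (if toℕ y <ᵇ toℕ x then a else b) * slotProduct a b (y ∷ xs)
  slotProduct a b _            = 1#

  slotProduct≈powers : ∀ a b {k} m (v : Vec (Fin k) (suc m)) →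
    slotProduct a b (toList v) ≈ (a ^ desL (toList v)) * (b ^ (m ∸ desL (toList v)))
  slotProduct≈powers a b zero    (x ∷ [])    = sym (*-identityʳ 1#)
  slotProduct≈powers a b (suc m) (x ∷ y ∷ w) with toℕ y <ᵇ toℕ x | desL-≤ m (y ∷ w)
  ... | true  | _    = trans (*-congˡ (slotProduct≈powers a b m (y ∷ w))) (sym (*-assoc _ _ _))
  ... | false | D≤m  = begin
    b * slotProduct a b (toList (y ∷ w))  ≈⟨ *-congˡ (slotProduct≈powers a b m (y ∷ w)) ⟩
    b * ((a ^ D) * (b ^ (m ∸ D)))         ≈⟨ sym (*-assoc _ _ _) ⟩
    (b * (a ^ D)) * (b ^ (m ∸ D))         ≈⟨ *-congʳ (*-comm _ _) ⟩
    ((a ^ D) * b) * (b ^ (m ∸ D))         ≈⟨ *-assoc _ _ _ ⟩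
    (a ^ D) * (b ^ suc (m ∸ D))           ≡⟨ ≡.cong (λ e → (a ^ D) * (b ^ e)) (+-∸-assoc 1 D≤m) ⟨
    (a ^ D) * (b ^ (suc m ∸ D))           ∎
    where
    D : ℕ
    D = desL (toList (y ∷ w))

  module _ (t q : Carrier) where

    barWeight : ∀ {n} → Vec (Fin n) n × Vec Bool (n ∸ 1) → Carrier
    barWeight σ = (t ^ desSP σ) * (q ^ seg σ)

    slotFactor : ∀ e → t ^ (if e then 1 else 0) + q ≈ (if e then t + q else 1# + q)
    slotFactor true  = +-congʳ (*-identityʳ t)
    slotFactor false = refl

    Σ-bars≈slotProduct : ∀ {k} m (v : Vec (Fin k) (suc m)) →
      Σ R (barChoices m) (λ bs → (t ^ desSegL (toList v) (toList bs)) * (q ^ countTrue bs))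
        ≈ slotProduct (t + q) (1# + q) (toList v)
    Σ-bars≈slotProduct zero    (x ∷ [])    = trans (+-identityʳ _) (*-identityʳ 1#)
    Σ-bars≈slotProduct (suc m) (x ∷ y ∷ w) = begin
      Σ R (barChoices (suc m)) weight
        ≈⟨ Σ-barChoices-suc m weight ⟩
      Σ R B (weight ∘ (true ∷_)) + Σ R B (weight ∘ (false ∷_))
        ≈⟨ +-cong (Σ-cong B λ _ → x∙yz≈y∙xz _ _ _)
                  (Σ-cong B λ _ → trans (*-congʳ (^-homo-* t [descent] _)) (*-assoc _ _ _)) ⟩
      Σ R B (λ bs → q * rest bs) + Σ R B (λ bs → (t ^ [descent]) * rest bs)
        ≈⟨ +-cong (*-distribˡ-Σ q B rest) (*-distribˡ-Σ (t ^ [descent]) B rest) ⟨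
      q * Σ R B rest + (t ^ [descent]) * Σ R B rest
        ≈⟨ distribʳ _ _ _ ⟨
      (q + t ^ [descent]) * Σ R B rest
        ≈⟨ *-cong (trans (+-comm _ _) (slotFactor descent)) (Σ-bars≈slotProduct m (y ∷ w)) ⟩
      slotProduct (t + q) (1# + q) (toList (x ∷ y ∷ w)) ∎
      where
      open CommutativeSemigroupProperties *-commutativeSemigroup using (x∙yz≈y∙xz)
      B : List (Vec Bool m)
      B = barChoices m
      descent : Bool
      descent = toℕ y <ᵇ toℕ x
      [descent] : ℕ
      [descent] = if descent then 1 else 0
      weight : Vec Bool (suc m) → Carrier
      weight bs = (t ^ desSegL (toList (x ∷ y ∷ w)) (toList bs)) * (q ^ countTrue bs)
      rest : Vec Bool m → Carrier
      rest bs = (t ^ desSegL (toList (y ∷ w)) (toList bs)) * (q ^ countTrue bs)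

    α-closedForm : ∀ m → α R (suc m) t q ≈ rhsα R (suc m) t q
    α-closedForm m = begin
      α R (suc m) t q
        ≈⟨ Σ-concatMap (λ π → map (π ,_) (barChoices m)) (perms (suc m)) barWeight ⟩
      Σ R (perms (suc m)) (λ π → Σ R (map (π ,_) (barChoices m)) barWeight)
        ≈⟨ Σ-cong (perms (suc m)) (λ π → trans (Σ-map (π ,_) (barChoices m) barWeight) (Σ-bars≈slotProduct m π)) ⟩
      Σ R (perms (suc m)) (λ π → slotProduct (t + q) (1# + q) (toList π))
        ≈⟨ Σ-cong (perms (suc m)) (slotProduct≈powers (t + q) (1# + q) m) ⟩
      Σ R (perms (suc m)) (λ π → ((t + q) ^ des π) * ((1# + q) ^ (m ∸ des π)))
        ≈⟨ Σ-groupBy des (λ k → ((t + q) ^ k) * ((1# + q) ^ (m ∸ k))) (suc m) (s≤s ∘ desL-≤ m) (perms (suc m)) ⟩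
      rhsα R (suc m) t q ∎

  1^n≈1 : ∀ n → 1# ^ n ≈ 1#
  1^n≈1 zero    = refl
  1^n≈1 (suc n) = trans (*-identityˡ _) (1^n≈1 n)

  P-closedForm : ∀ m t → P R (suc m) t ≈ rhsP R (suc m) t
  P-closedForm m t = trans (Σ-cong (SP (suc m)) t^d≈t^d*1^s) (α-closedForm t 1# m)
    where
    t^d≈t^d*1^s : ∀ σ → t ^ desSP σ ≈ (t ^ desSP σ) * (1# ^ seg σ)
    t^d≈t^d*1^s σ = sym (trans (*-congˡ (1^n≈1 (seg σ))) (*-identityʳ _))

theorem3p4 : {c ℓ : Level} (R : CommutativeSemiring c ℓ) (n : ℕ) → 1 ≤ n →
    ((t q : CommutativeSemiring.Carrier R) →
      CommutativeSemiring._≈_ R (α R n t q) (rhsα R n t q))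
    × ((t : CommutativeSemiring.Carrier R) →
      CommutativeSemiring._≈_ R (P R n t) (rhsP R n t))
theorem3p4 R (suc m) _ = (λ t q → α-closedForm R t q m) , P-closedForm R m
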